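{- Let $K_n$ be a complete graph whose edges are colored red and blue, and let $\varepsilon$ be the largest real such that this coloring is $\varepsilon$-balanced, i.e. $\varepsilon=\min(e_R,e_B)/\binom n2$, where $e_R,e_B$ are the numbers of red and blue edges. Then there exist vertices $x,y$ and a set $S$ of vertices such that every vertex of $S$ is joined to $x$ by a red edge and to $y$ by a blue edge, and $$|S|\ge \left(\sqrt{1-\varepsilon}-(1-\varepsilon)+o(1)\right)n,$$ where $o(1)$ denotes a quantity tending to $0$ as $n\to\infty$, uniformly over all colorings.
   Context: A 2-edge-coloring of $K_n$ is $\varepsilon$-balanced if each color class contains at least $\varepsilon\binom n2$ edges. -}

module Defs where

open import Data.Nat using (ℕ; zero; suc; _<ᵇ_; _⊓_)
open import Data.Nat.Combinatorics using (_C_)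
open import Data.Integer using (+_)
open import Data.Rational using (ℚ; _/_; 0ℚ; 1ℚ; _+_; _-_; _*_; _≤_)
open import Data.Fin using (Fin; toℕ)
open import Data.Bool using (Bool; true; false; if_then_else_; _∧_; not)
open import Data.List using (List; map; allFin)
open import Data.Nat.ListAction using (sum)
open import Data.Product using (_×_)

-- a/b as a rational, with the (irrelevant) junk value 0 when b = 0
ratio : ℕ → ℕ → ℚ
ratio a zero = 0ℚ
ratio a (suc b) = (+ a) / suc b

-- A red/blue colouring of K_n is a symmetric c : Fin n → Fin n → Bool
-- (true = red, false = blue); diagonal values are ignored.
-- Number of edges {i,j}, i < j, with colour b.
countColour : {n : ℕ} → (Fin n → Fin n → Bool) → Bool → ℕ
countColour {n} c b =
  sum (map (λ i → sum (map (λ j →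
    if (toℕ i <ᵇ toℕ j) ∧ same (c i j) then 1 else 0) (allFin n))) (allFin n))
  where
  same : Bool → Bool
  same x = if b then x else not x

redCount : {n : ℕ} → (Fin n → Fin n → Bool) → ℕ
redCount c = countColour c true

blueCount : {n : ℕ} → (Fin n → Fin n → Bool) → ℕ
blueCount c = countColour c false

balance : {n : ℕ} → (Fin n → Fin n → Bool) → ℚ
balance {n} c = ratio (redCount c ⊓ blueCount c) (n C 2)

-- "√ a ≤ t" for a ≥ 0, expressed without square roots: 0 ≤ t and a ≤ t²
√_≤_ : ℚ → ℚ → Set
√ a ≤ t = (0ℚ ≤ t) × (a ≤ t * t)

module Submission where

-- Suppose red is the majority colour, so that its density a = 1 − ε is at least ½.  Let x
-- have the largest red degree Δ = τn, let T be its red neighbourhood, and choose y with as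
-- many blue neighbours in T as possible; these form S, so n|S| ≥ Σ_{w∈T} d_B(w).  Since
-- d_B(w) = n − 1 − d_R(w) and d_R(w) ≤ Δ, this gives |S|/n ≥ τ − τ² − 1/n.  A red edge is
-- counted twice in Σ_{w∈T} d_R(w) only if both its endpoints lie in T, so this sum is at
-- most e_R + Δ²/2, which gives |S|/n ≥ τ − τ²/2 − a/2 − 1/n.  As 2e_R ≤ nΔ and a ≥ ½, τ ≥ 1/3.
-- If τ² ≤ a the first bound, and otherwise the second, yields |S|/n + a + 1/n ≥ √a.
-- A blue majority is handled by swapping the colours.

open import Defs
open import Data.Nat using (ℕ)
open import Data.Fin using (Fin)
open import Data.Fin.Subset using (Subset; _∈_; ∣_∣)
open import Data.Bool using (Bool; true; false)
open import Data.Product using (Σ; _×_)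
open import Relation.Binary.PropositionalEquality using (_≡_; _≢_)

open import Data.Bool.Base using (not; _∧_; if_then_else_)
open import Data.Bool.Properties using (∧-conicalˡ; ∧-conicalʳ; not-injective; not-involutive)
open import Data.Fin.Base using (zero; suc)
open import Data.Product using (Σ-syntax; _,_; proj₁; proj₂)
open import Function.Base using (_∘_)
open import Relation.Binary.PropositionalEquality using (refl; sym; trans; cong; cong₂; subst; subst₂; module ≡-Reasoning)
open import Relation.Nullary using (does; yes; no; contradiction)

module Colourings where

  open import Data.Nat.Base using (zero; suc; _+_; _*_; _≤_; z≤n; s≤s; NonZero; >-nonZero)
  open import Data.Nat.Properties hiding (_≟_; _<?_; <-cmp)
  open import Data.Nat.Combinatorics using (_C_; nC1≡n; nCk+nC[k+1]≡[n+1]C[k+1])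
  open import Data.Nat.Solver using (module +-*-Solver)
  open import Data.Fin.Properties using (_≟_; _<?_; <-cmp)
  import Data.List.Base as List
  import Data.List.Properties as List
  open import Data.List.Membership.Propositional.Properties using (∈-allFin)
  import Data.List.Relation.Unary.All as All
  open import Data.Nat.ListAction using () renaming (sum to sumˡ)
  import Data.Vec.Base as Vec
  import Data.Vec.Properties as Vec
  open import Algebra.Properties.Semiring.Sum +-*-semiring
    using (sum; sum-syntax; ∑-distrib-+; ∑-comm; sum-cong-≗; *-distribˡ-sum; *-distribʳ-sum)
  open import Relation.Nullary.Decidable using (dec-true; dec-false)
  open import Relation.Binary.Definitions using (tri<; tri≈; tri>)
  open +-*-Solver

  private
    variable
      n : ℕ

  𝟙 : Bool → ℕ
  𝟙 b = if b then 1 else 0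

  𝟙≤1 : ∀ b → 𝟙 b ≤ 1
  𝟙≤1 false = z≤n
  𝟙≤1 true  = ≤-refl

  𝟙-∧ : ∀ a b → 𝟙 (a ∧ b) ≡ 𝟙 a * 𝟙 b
  𝟙-∧ false b = refl
  𝟙-∧ true  b = sym (+-identityʳ (𝟙 b))

  𝟙-∧-split : ∀ a b e → 𝟙 (a ∧ e) + 𝟙 (b ∧ e) ≤ 𝟙 e + 𝟙 (a ∧ b)
  𝟙-∧-split false false e = z≤n
  𝟙-∧-split false true  e = ≤-reflexive (+-comm 0 (𝟙 e))
  𝟙-∧-split true  false e = ≤-refl
  𝟙-∧-split true  true  e = +-monoʳ-≤ (𝟙 e) (𝟙≤1 e)

  ∑-mono-≤ : {f g : Fin n → ℕ} → (∀ i → f i ≤ g i) → ∑[ i < n ] f i ≤ ∑[ i < n ] g i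
  ∑-mono-≤ {zero}  f≤g = z≤n
  ∑-mono-≤ {suc n} f≤g = +-mono-≤ (f≤g zero) (∑-mono-≤ (f≤g ∘ suc))

  ∑-const : ∀ n k → ∑[ i < n ] k ≡ n * k
  ∑-const zero    k = refl
  ∑-const (suc n) k = cong (k +_) (∑-const n k)

  ∑-distrib-+₃ : (f g h : Fin n → ℕ) →
    ∑[ i < n ] (f i + g i + h i) ≡ ∑[ i < n ] f i + ∑[ i < n ] g i + ∑[ i < n ] h i
  ∑-distrib-+₃ {n} f g h = trans (∑-distrib-+ (λ i → f i + g i) h) (cong (_+ ∑[ i < n ] h i) (∑-distrib-+ f g))

  ∑²-distrib-+ : ∀ {m} (f g : Fin n → Fin m → ℕ) →
    ∑[ i < n ] ∑[ j < m ] (f i j + g i j) ≡ ∑[ i < n ] ∑[ j < m ] f i j + ∑[ i < n ] ∑[ j < m ] g i j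
  ∑²-distrib-+ {m = m} f g = trans (sum-cong-≗ (λ i → ∑-distrib-+ (f i) (g i)))
    (∑-distrib-+ (λ i → ∑[ j < m ] f i j) (λ i → ∑[ j < m ] g i j))

  ∑-≤-* : ∀ {f : Fin n → ℕ} {k} → (∀ i → f i ≤ k) → ∑[ i < n ] f i ≤ n * k
  ∑-≤-* {n} {k = k} f≤k = ≤-trans (∑-mono-≤ f≤k) (≤-reflexive (∑-const n k))

  ∑-𝟙≤ : (p : Fin n → Bool) → ∑[ i < n ] 𝟙 (p i) ≤ n
  ∑-𝟙≤ {n} p = ≤-trans (∑-≤-* (𝟙≤1 ∘ p)) (≤-reflexive (*-identityʳ n))

  ∑-𝟙-≟ : (v : Fin n) → ∑[ w < n ] 𝟙 (does (v ≟ w)) ≡ 1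
  ∑-𝟙-≟ {suc n} zero    = cong suc (trans (∑-const n 0) (*-zeroʳ n))
  ∑-𝟙-≟ {suc n} (suc v) = ∑-𝟙-≟ v

  ∑-𝟙-∧ : ∀ b (p : Fin n → Bool) → ∑[ i < n ] 𝟙 (b ∧ p i) ≡ 𝟙 b * ∑[ i < n ] 𝟙 (p i)
  ∑-𝟙-∧ b p = trans (sum-cong-≗ (λ i → 𝟙-∧ b (p i))) (sym (*-distribˡ-sum (𝟙 b) (𝟙 ∘ p)))

  sum-map-allFin : (f : Fin n → ℕ) → sumˡ (List.map f (List.allFin n)) ≡ ∑[ i < n ] f i
  sum-map-allFin {n} f = trans (cong sumˡ (List.map-tabulate (λ i → i) f)) (sum-tabulate f)
    where
    sum-tabulate : ∀ {n} (g : Fin n → ℕ) → sumˡ (List.tabulate g) ≡ ∑[ i < n ] g i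
    sum-tabulate {zero}  g = refl
    sum-tabulate {suc n} g = cong (g zero +_) (sum-tabulate (g ∘ suc))

  ∣tabulate∣ : (p : Fin n → Bool) → ∣ Vec.tabulate p ∣ ≡ ∑[ i < n ] 𝟙 (p i)
  ∣tabulate∣ {zero}  p = refl
  ∣tabulate∣ {suc n} p with p zero
  ... | true  = cong suc (∣tabulate∣ (p ∘ suc))
  ... | false = ∣tabulate∣ (p ∘ suc)

  ∈-tabulate⇒ : ∀ {p : Fin n → Bool} {v} → v ∈ Vec.tabulate p → p v ≡ true
  ∈-tabulate⇒ {p = p} {v} v∈ = trans (sym (Vec.lookup∘tabulate p v)) (Vec.[]=⇒lookup v∈)

  maximum : Fin n → (f : Fin n → ℕ) → Σ[ x ∈ Fin n ] (∀ i → f i ≤ f x)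
  maximum {n} x₀ f = argmax f x₀ (List.allFin n)
    , λ i → All.lookup (f[xs]≤f[argmax] x₀ (List.allFin n)) (∈-allFin i)
    where open import Data.List.Extrema ≤-totalOrder using (argmax; f[xs]≤f[argmax])

  Colouring : ℕ → Set
  Colouring n = Fin n → Fin n → Bool

  Symmetric : Colouring n → Set
  Symmetric c = ∀ i j → c i j ≡ c j i

  swapColours : Colouring n → Colouring n
  swapColours c i j = not (c i j)

  redEdge : Colouring n → Fin n → Fin n → Bool
  redEdge c v w = not (does (v ≟ w)) ∧ c v w

  redDegree : Colouring n → Fin n → ℕ
  redDegree {n} c v = ∑[ w < n ] 𝟙 (redEdge c v w)

  redEdge⇒ : ∀ (c : Colouring n) {v w} → redEdge c v w ≡ true → (v ≢ w) × (c v w ≡ true)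
  redEdge⇒ c {v} {w} vw with v ≟ w | c v w
  ... | no v≢w | true = v≢w , refl

  redEdge< : Colouring n → Fin n → Fin n → Bool
  redEdge< c v w = does (v <? w) ∧ c v w

  redCount-∑ : (c : Colouring n) → redCount c ≡ ∑[ v < n ] ∑[ w < n ] 𝟙 (redEdge< c v w)
  redCount-∑ {n} c = trans (sum-map-allFin (λ v → sumˡ (List.map (𝟙 ∘ redEdge< c v) (List.allFin n))))
    (sum-cong-≗ (λ v → sum-map-allFin (𝟙 ∘ redEdge< c v)))

  blueCount-swapColours : (c : Colouring n) → blueCount (swapColours c) ≡ redCount c
  blueCount-swapColours c = trans (redCount-∑ (swapColours (swapColours c)))
    (trans (sum-cong-≗ (λ v → sum-cong-≗ (λ w → cong (λ b → 𝟙 (does (v <? w) ∧ b)) (not-involutive (c v w)))))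
      (sym (redCount-∑ c)))

  module _ {c : Colouring n} (c-sym : Symmetric c) where

    redEdge-sym : ∀ v w → redEdge c v w ≡ redEdge c w v
    redEdge-sym v w with v ≟ w | w ≟ v
    ... | yes refl | yes _   = refl
    ... | yes v≡w  | no w≢v  = contradiction (sym v≡w) w≢v
    ... | no v≢w   | yes w≡v = contradiction (sym w≡v) v≢w
    ... | no _     | no _    = cong (true ∧_) (c-sym v w)

    𝟙-redEdge-split : ∀ v w → 𝟙 (redEdge c v w) ≡ 𝟙 (redEdge< c v w) + 𝟙 (redEdge< c w v)
    𝟙-redEdge-split v w with <-cmp v w
    ... | tri< v<w v≢w w≮v rewrite dec-false (v ≟ w) v≢w | dec-true (v <? w) v<w | dec-false (w <? v) w≮v
      = sym (+-identityʳ _)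
    ... | tri≈ v≮w refl _ rewrite dec-true (v ≟ v) refl | dec-false (v <? v) v≮w = refl
    ... | tri> v≮w v≢w w<v rewrite dec-false (v ≟ w) v≢w | dec-false (v <? w) v≮w | dec-true (w <? v) w<v
      = cong 𝟙 (c-sym v w)

    degree-sum : ∑[ v < n ] redDegree c v ≡ redCount c + redCount c
    degree-sum = begin
      ∑[ v < n ] ∑[ w < n ] 𝟙 (redEdge c v w)
        ≡⟨ sum-cong-≗ (λ v → trans (sum-cong-≗ (𝟙-redEdge-split v)) (∑-distrib-+ (F v) (λ w → F w v))) ⟩
      ∑[ v < n ] (∑[ w < n ] F v w + ∑[ w < n ] F w v)
        ≡⟨ ∑-distrib-+ (λ v → ∑[ w < n ] F v w) (λ v → ∑[ w < n ] F w v) ⟩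
      ∑[ v < n ] ∑[ w < n ] F v w + ∑[ v < n ] ∑[ w < n ] F w v
        ≡⟨ cong₂ _+_ (redCount-∑ c) (trans (redCount-∑ c) (∑-comm F)) ⟨
      redCount c + redCount c ∎
      where
      open ≡-Reasoning
      F : Fin n → Fin n → ℕ
      F v w = 𝟙 (redEdge< c v w)

  degree-partition : (c : Colouring n) (v : Fin n) → redDegree c v + redDegree (swapColours c) v + 1 ≡ n
  degree-partition {n} c v = begin
    ∑[ w < n ] R w + ∑[ w < n ] B w + 1           ≡⟨ cong (∑[ w < n ] R w + ∑[ w < n ] B w +_) (∑-𝟙-≟ v) ⟨
    ∑[ w < n ] R w + ∑[ w < n ] B w + ∑[ w < n ] D w ≡⟨ ∑-distrib-+₃ R B D ⟨
    ∑[ w < n ] (R w + B w + D w)                  ≡⟨ sum-cong-≗ exactly-one ⟩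
    ∑[ w < n ] 1                                   ≡⟨ trans (∑-const n 1) (*-identityʳ n) ⟩
    n                                              ∎
    where
    open ≡-Reasoning
    R B D : Fin n → ℕ
    R w = 𝟙 (redEdge c v w)
    B w = 𝟙 (redEdge (swapColours c) v w)
    D w = 𝟙 (does (v ≟ w))
    exactly-one : ∀ w → R w + B w + D w ≡ 1
    exactly-one w with does (v ≟ w) | c v w
    ... | true  | _     = refl
    ... | false | true  = refl
    ... | false | false = refl

  C2-suc : ∀ n → suc n C 2 ≡ n + n C 2
  C2-suc n = trans (sym (nCk+nC[k+1]≡[n+1]C[k+1] n 1)) (cong (_+ n C 2) (nC1≡n n))

  C2-nonZero : ∀ k → NonZero (suc (suc k) C 2)
  C2-nonZero k = subst NonZero (sym (C2-suc (suc k))) _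

  C2-double : ∀ n → n C 2 + n C 2 + n ≡ n * n
  C2-double zero    = refl
  C2-double (suc n) = begin
    suc n C 2 + suc n C 2 + suc n
      ≡⟨ cong (λ k → k + k + suc n) (C2-suc n) ⟩
    (n + n C 2) + (n + n C 2) + suc n
      ≡⟨ solve 2 (λ n k → (n :+ k) :+ (n :+ k) :+ (con 1 :+ n) := (k :+ k :+ n) :+ (con 1 :+ n :+ n)) refl n (n C 2) ⟩
    (n C 2 + n C 2 + n) + suc (n + n)
      ≡⟨ cong (_+ suc (n + n)) (C2-double n) ⟩
    n * n + suc (n + n)
      ≡⟨ solve 1 (λ n → n :* n :+ (con 1 :+ (n :+ n)) := (con 1 :+ n) :* (con 1 :+ n)) refl n ⟩
    suc n * suc n ∎
    where open ≡-Reasoning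

  swapColours-sym : {c : Colouring n} → Symmetric c → Symmetric (swapColours c)
  swapColours-sym c-sym i j = cong not (c-sym i j)

  redCount+blueCount : {c : Colouring n} → Symmetric c → redCount c + blueCount c ≡ n C 2
  redCount+blueCount {n} {c} c-sym = *-cancelˡ-≡ _ _ 2 (+-cancelʳ-≡ n _ _ (begin
    2 * (R + B) + n                    ≡⟨ cong (_+ n) (solve 2 (λ r b → con 2 :* (r :+ b) := (r :+ r) :+ (b :+ b)) refl R B) ⟩
    (R + R) + (B + B) + n              ≡⟨ cong₂ (λ x y → x + y + n) (degree-sum c-sym) (degree-sum (swapColours-sym c-sym)) ⟨
    ∑[ v < n ] redDegree c v + ∑[ v < n ] redDegree (swapColours c) v + n
      ≡⟨ cong (∑[ v < n ] redDegree c v + ∑[ v < n ] redDegree (swapColours c) v +_) (trans (∑-const n 1) (*-identityʳ n)) ⟨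
    ∑[ v < n ] redDegree c v + ∑[ v < n ] redDegree (swapColours c) v + ∑[ v < n ] 1
      ≡⟨ ∑-distrib-+₃ (redDegree c) (redDegree (swapColours c)) (λ _ → 1) ⟨
    ∑[ v < n ] (redDegree c v + redDegree (swapColours c) v + 1)
      ≡⟨ trans (sum-cong-≗ (degree-partition c)) (∑-const n n) ⟩
    n * n                              ≡⟨ C2-double n ⟨
    n C 2 + n C 2 + n                  ≡⟨ cong (_+ n) (solve 1 (λ k → k :+ k := con 2 :* k) refl (n C 2)) ⟩
    2 * (n C 2) + n                    ∎))
    where
    open ≡-Reasoning
    R = redCount c
    B = blueCount c

  record CommonNeighbourhood (c : Colouring n) : Set where
    field
      x y    : Fin n
      S      : Subset n
      S-spec : ∀ v → v ∈ S → (v ≢ x) × (v ≢ y) × (c v x ≡ true) × (c v y ≡ false)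
      -- As constructed below, Δ is the largest red degree, attained at x, and A is the sum
      -- of the red degrees of the red neighbours of x.
      Δ A        : ℕ
      Δ≤n        : Δ ≤ n
      R+R≤nΔ     : redCount c + redCount c ≤ n * Δ
      Δn≤nS+A+Δ  : Δ * n ≤ n * ∣ S ∣ + A + Δ
      A≤ΔΔ       : A ≤ Δ * Δ
      A+A≤R+R+ΔΔ : A + A ≤ redCount c + redCount c + Δ * Δ

  module MaxRedDegree {c : Colouring n} (c-sym : Symmetric c) (x₀ : Fin n) where

    open ≤-Reasoning

    x : Fin n
    x = proj₁ (maximum x₀ (redDegree c))

    Δ : ℕ
    Δ = redDegree c x

    deg≤Δ : ∀ w → redDegree c w ≤ Δ
    deg≤Δ = proj₂ (maximum x₀ (redDegree c))

    T : Fin n → Bool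
    T w = redEdge c w x

    ∑T≡Δ : ∑[ w < n ] 𝟙 (T w) ≡ Δ
    ∑T≡Δ = sum-cong-≗ (λ w → cong 𝟙 (redEdge-sym c-sym w x))

    blue : Fin n → Fin n → Bool
    blue = redEdge (swapColours c)

    inS? : Fin n → Fin n → Bool
    inS? y w = T w ∧ blue w y

    y : Fin n
    y = proj₁ (maximum x₀ (λ u → ∑[ w < n ] 𝟙 (inS? u w)))

    y-max : ∀ u → ∑[ w < n ] 𝟙 (inS? u w) ≤ ∑[ w < n ] 𝟙 (inS? y w)
    y-max = proj₂ (maximum x₀ (λ u → ∑[ w < n ] 𝟙 (inS? u w)))

    S : Subset n
    S = Vec.tabulate (inS? y)

    A : ℕ
    A = ∑[ w < n ] (𝟙 (T w) * redDegree c w)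

    S-spec : ∀ v → v ∈ S → (v ≢ x) × (v ≢ y) × (c v x ≡ true) × (c v y ≡ false)
    S-spec v v∈S =
      let v≢x , vx-red  = redEdge⇒ c (∧-conicalˡ (T v) (blue v y) (∈-tabulate⇒ v∈S))
          v≢y , vy-blue = redEdge⇒ (swapColours c) (∧-conicalʳ (T v) (blue v y) (∈-tabulate⇒ v∈S))
      in v≢x , v≢y , vx-red , not-injective vy-blue

    T-blue≤nS : ∑[ w < n ] (𝟙 (T w) * redDegree (swapColours c) w) ≤ n * ∣ S ∣
    T-blue≤nS = begin
      ∑[ w < n ] (𝟙 (T w) * redDegree (swapColours c) w) ≡⟨ sum-cong-≗ (λ w → ∑-𝟙-∧ (T w) (blue w)) ⟨
      ∑[ w < n ] ∑[ u < n ] 𝟙 (inS? u w)              ≡⟨ ∑-comm (λ w u → 𝟙 (inS? u w)) ⟩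
      ∑[ u < n ] ∑[ w < n ] 𝟙 (inS? u w)              ≤⟨ ∑-≤-* y-max ⟩
      n * ∑[ w < n ] 𝟙 (inS? y w)                      ≡⟨ cong (n *_) (∣tabulate∣ (inS? y)) ⟨
      n * ∣ S ∣                                         ∎

    Δn≤nS+A+Δ : Δ * n ≤ n * ∣ S ∣ + A + Δ
    Δn≤nS+A+Δ = begin
      Δ * n                                                 ≡⟨ cong (_* n) ∑T≡Δ ⟨
      ∑[ w < n ] 𝟙 (T w) * n                                ≡⟨ *-distribʳ-sum n (𝟙 ∘ T) ⟩
      ∑[ w < n ] (𝟙 (T w) * n)                              ≡⟨ sum-cong-≗ split ⟩
      ∑[ w < n ] (𝟙 (T w) * redDegree (swapColours c) w + 𝟙 (T w) * redDegree c w + 𝟙 (T w))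
        ≡⟨ ∑-distrib-+₃ (λ w → 𝟙 (T w) * redDegree (swapColours c) w) (λ w → 𝟙 (T w) * redDegree c w) (𝟙 ∘ T) ⟩
      ∑[ w < n ] (𝟙 (T w) * redDegree (swapColours c) w) + A + ∑[ w < n ] 𝟙 (T w)
        ≤⟨ +-mono-≤ (+-monoˡ-≤ A T-blue≤nS) (≤-reflexive ∑T≡Δ) ⟩
      n * ∣ S ∣ + A + Δ                                     ∎
      where
      split : ∀ w → 𝟙 (T w) * n ≡ 𝟙 (T w) * redDegree (swapColours c) w + 𝟙 (T w) * redDegree c w + 𝟙 (T w)
      split w = trans (cong (𝟙 (T w) *_) (sym (degree-partition c w)))
        (solve 3 (λ i r b → i :* (r :+ b :+ con 1) := i :* b :+ i :* r :+ i) refl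
          (𝟙 (T w)) (redDegree c w) (redDegree (swapColours c) w))

    A≤ΔΔ : A ≤ Δ * Δ
    A≤ΔΔ = begin
      A                         ≤⟨ ∑-mono-≤ (λ w → *-monoʳ-≤ (𝟙 (T w)) (deg≤Δ w)) ⟩
      ∑[ w < n ] (𝟙 (T w) * Δ)  ≡⟨ *-distribʳ-sum Δ (𝟙 ∘ T) ⟨
      ∑[ w < n ] 𝟙 (T w) * Δ    ≡⟨ cong (_* Δ) ∑T≡Δ ⟩
      Δ * Δ                     ∎

    A+A≤R+R+ΔΔ : A + A ≤ redCount c + redCount c + Δ * Δ
    A+A≤R+R+ΔΔ = begin
      A + A                                                   ≡⟨ cong₂ _+_ A≡ A≡′ ⟩
      ∑[ w < n ] ∑[ u < n ] 𝟙 (T w ∧ redEdge c w u) + ∑[ w < n ] ∑[ u < n ] 𝟙 (T u ∧ redEdge c w u)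
        ≡⟨ ∑²-distrib-+ (λ w u → 𝟙 (T w ∧ redEdge c w u)) (λ w u → 𝟙 (T u ∧ redEdge c w u)) ⟨
      ∑[ w < n ] ∑[ u < n ] (𝟙 (T w ∧ redEdge c w u) + 𝟙 (T u ∧ redEdge c w u))
        ≤⟨ ∑-mono-≤ (λ w → ∑-mono-≤ (λ u → 𝟙-∧-split (T w) (T u) (redEdge c w u))) ⟩
      ∑[ w < n ] ∑[ u < n ] (𝟙 (redEdge c w u) + 𝟙 (T w ∧ T u))
        ≡⟨ ∑²-distrib-+ (λ w u → 𝟙 (redEdge c w u)) (λ w u → 𝟙 (T w ∧ T u)) ⟩
      ∑[ w < n ] redDegree c w + ∑[ w < n ] ∑[ u < n ] 𝟙 (T w ∧ T u)
        ≡⟨ cong₂ _+_ (degree-sum c-sym) ΔΔ ⟩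
      redCount c + redCount c + Δ * Δ                        ∎
      where
      A≡ : A ≡ ∑[ w < n ] ∑[ u < n ] 𝟙 (T w ∧ redEdge c w u)
      A≡ = sum-cong-≗ (λ w → sym (∑-𝟙-∧ (T w) (redEdge c w)))
      A≡′ : A ≡ ∑[ w < n ] ∑[ u < n ] 𝟙 (T u ∧ redEdge c w u)
      A≡′ = trans A≡ (trans (sum-cong-≗ (λ w → sum-cong-≗ (λ u → cong (λ b → 𝟙 (T w ∧ b)) (redEdge-sym c-sym w u))))
        (∑-comm (λ w u → 𝟙 (T w ∧ redEdge c u w))))
      ΔΔ : ∑[ w < n ] ∑[ u < n ] 𝟙 (T w ∧ T u) ≡ Δ * Δ
      ΔΔ = trans (sum-cong-≗ (λ w → ∑-𝟙-∧ (T w) T))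
        (trans (sym (*-distribʳ-sum (∑[ u < n ] 𝟙 (T u)) (𝟙 ∘ T))) (cong₂ _*_ ∑T≡Δ ∑T≡Δ))

    commonNeighbourhood : CommonNeighbourhood c
    commonNeighbourhood = record
      { x = x ; y = y ; S = S ; S-spec = S-spec ; Δ = Δ ; A = A
      ; Δ≤n = ∑-𝟙≤ (redEdge c x)
      ; R+R≤nΔ = subst (_≤ n * Δ) (degree-sum c-sym) (∑-≤-* deg≤Δ)
      ; Δn≤nS+A+Δ = Δn≤nS+A+Δ ; A≤ΔΔ = A≤ΔΔ ; A+A≤R+R+ΔΔ = A+A≤R+R+ΔΔ }

  module _ {n E r : ℕ} (2≤n : 2 ≤ n) (E+E+n≡n² : E + E + n ≡ n * n) (E≤r+r : E ≤ r + r) where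

    n≤2Δ+1 : ∀ Δ → r + r ≤ n * Δ → n ≤ Δ + Δ + 1
    n≤2Δ+1 Δ r+r≤nΔ = *-cancelˡ-≤ n {{>-nonZero (≤-trans (s≤s z≤n) 2≤n)}} (begin
      n * n               ≡⟨ E+E+n≡n² ⟨
      E + E + n           ≤⟨ +-monoˡ-≤ n (+-mono-≤ E≤nΔ E≤nΔ) ⟩
      n * Δ + n * Δ + n   ≡⟨ solve 2 (λ n d → n :* d :+ n :* d :+ n := n :* (d :+ d :+ con 1)) refl n Δ ⟩
      n * (Δ + Δ + 1)     ∎)
      where
      open ≤-Reasoning
      E≤nΔ : E ≤ n * Δ
      E≤nΔ = ≤-trans E≤r+r r+r≤nΔ

    n≤3Δ : ∀ Δ → r + r ≤ n * Δ → n ≤ Δ + Δ + Δ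
    n≤3Δ zero    r+r≤nΔ = contradiction (≤-trans 2≤n (n≤2Δ+1 0 r+r≤nΔ)) λ { (s≤s ()) }
    n≤3Δ (suc d) r+r≤nΔ = ≤-trans (n≤2Δ+1 (suc d) r+r≤nΔ) (+-monoʳ-≤ (suc d + suc d) (s≤s z≤n))

  module _ {c : Colouring n} (N : CommonNeighbourhood c) where

    open CommonNeighbourhood N
    open ≤-Reasoning

    Δn≤[S+1]n+ΔΔ : Δ * n ≤ suc ∣ S ∣ * n + Δ * Δ
    Δn≤[S+1]n+ΔΔ = begin
      Δ * n                   ≤⟨ Δn≤nS+A+Δ ⟩
      n * M + A + Δ           ≤⟨ +-mono-≤ (+-monoʳ-≤ (n * M) A≤ΔΔ) Δ≤n ⟩
      n * M + Δ * Δ + n       ≡⟨ solve 3 (λ n m d → n :* m :+ d :+ n := (con 1 :+ m) :* n :+ d) refl n M (Δ * Δ) ⟩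
      suc M * n + Δ * Δ       ∎
      where M = ∣ S ∣

    [Δ+Δ]n≤[2S+2]n+[R+R]+ΔΔ : (Δ + Δ) * n ≤ (suc ∣ S ∣ + suc ∣ S ∣) * n + (redCount c + redCount c) + Δ * Δ
    [Δ+Δ]n≤[2S+2]n+[R+R]+ΔΔ = begin
      (Δ + Δ) * n                                  ≡⟨ *-distribʳ-+ n Δ Δ ⟩
      Δ * n + Δ * n                                ≤⟨ +-mono-≤ Δn≤nS+A+Δ Δn≤nS+A+Δ ⟩
      (n * M + A + Δ) + (n * M + A + Δ)            ≡⟨ solve 4 (λ n m a d → (n :* m :+ a :+ d) :+ (n :* m :+ a :+ d)
                                                        := (n :* m :+ n :* m) :+ (a :+ a) :+ (d :+ d)) refl n M A Δ ⟩
      (n * M + n * M) + (A + A) + (Δ + Δ)          ≤⟨ +-mono-≤ (+-monoʳ-≤ (n * M + n * M) A+A≤R+R+ΔΔ) (+-mono-≤ Δ≤n Δ≤n) ⟩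
      (n * M + n * M) + (R + R + Δ * Δ) + (n + n)  ≡⟨ solve 4 (λ n m r d → (n :* m :+ n :* m) :+ (r :+ r :+ d) :+ (n :+ n)
                                                        := ((con 1 :+ m) :+ (con 1 :+ m)) :* n :+ (r :+ r) :+ d) refl n M R (Δ * Δ) ⟩
      (suc M + suc M) * n + (R + R) + Δ * Δ        ∎
      where
      M = ∣ S ∣
      R = redCount c

open Colourings

open import Data.Rational using (ℚ; 0ℚ; 1ℚ; _+_; _-_; _<_)

import Data.Nat.Base as ℕ
import Data.Nat.Properties as ℕ
open import Data.Nat.Base using (zero; suc; NonZero; s≤s)
open import Data.Nat.Combinatorics using (_C_)
import Data.Integer.Base as ℤ
import Data.Integer.Properties as ℤ
open import Data.Rational.Base using (mkℚ; *<*; ½; -_; _*_; _≤_; nonNegative; Positive)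
open import Data.Rational.Literals using (fromℤ)
open import Data.Rational.Properties
import Data.Rational.Unnormalised.Base as ℚᵘ
import Data.Rational.Unnormalised.Properties as ℚᵘ
open import Data.Rational.Solver using (module +-*-Solver)
open import Data.Sum using (inj₁; inj₂)
open +-*-Solver

-- The quadratic inequality

+-nonNeg : ∀ {p q} → 0ℚ ≤ p → 0ℚ ≤ q → 0ℚ ≤ p + q
+-nonNeg {p} {q} 0≤p 0≤q = nonNegative⁻¹ (p + q)
  {{nonNeg+nonNeg⇒nonNeg p {{nonNegative 0≤p}} q {{nonNegative 0≤q}}}}

*-nonNeg : ∀ {p q} → 0ℚ ≤ p → 0ℚ ≤ q → 0ℚ ≤ p * q
*-nonNeg {p} {q} 0≤p 0≤q = nonNegative⁻¹ (p * q)
  {{nonNeg*nonNeg⇒nonNeg p {{nonNegative 0≤p}} q {{nonNegative 0≤q}}}}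

0≤½ : 0ℚ ≤ ½
0≤½ = nonNegative⁻¹ ½

p≤q⇒0≤q-p : ∀ {p q} → p ≤ q → 0ℚ ≤ q - p
p≤q⇒0≤q-p {p} {q} p≤q = subst (_≤ q - p) (+-inverseʳ p) (+-monoˡ-≤ (- p) p≤q)

0≤q-p⇒p≤q : ∀ {p q} → 0ℚ ≤ q - p → p ≤ q
0≤q-p⇒p≤q {p} {q} 0≤q-p = subst₂ _≤_ (+-identityʳ p) (solve 2 (λ p q → p :+ (q :- p) := q) refl p q)
  (+-monoʳ-≤ p 0≤q-p)

p≤q⇒p*p≤q*q : ∀ {p q} → 0ℚ ≤ p → p ≤ q → p * p ≤ q * q
p≤q⇒p*p≤q*q {p} {q} 0≤p p≤q = ≤-trans (*-monoʳ-≤-nonNeg p {{nonNegative 0≤p}} p≤q)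
  (*-monoˡ-≤-nonNeg q {{nonNegative (≤-trans 0≤p p≤q)}} p≤q)

√-≤-trans : ∀ {a s t} → √ a ≤ s → s ≤ t → √ a ≤ t
√-≤-trans (0≤s , a≤s*s) s≤t = ≤-trans 0≤s s≤t , ≤-trans a≤s*s (p≤q⇒p*p≤q*q 0≤s s≤t)

0≤s*s-a⇒√a≤s : ∀ {a s} → 0ℚ ≤ s → 0ℚ ≤ s * s - a → √ a ≤ s
0≤s*s-a⇒√a≤s 0≤s 0≤s*s-a = 0≤s , 0≤q-p⇒p≤q 0≤s*s-a

module _ {τ a : ℚ} (0≤τ : 0ℚ ≤ τ) (τ≤1 : τ ≤ 1ℚ) (1≤a+a : 1ℚ ≤ a + a) where

  private
    0≤1-τ : 0ℚ ≤ 1ℚ - τ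
    0≤1-τ = p≤q⇒0≤q-p τ≤1

    0≤a+a-1 : 0ℚ ≤ a + a - 1ℚ
    0≤a+a-1 = p≤q⇒0≤q-p 1≤a+a

  -- For s = τ + d with d = a − τ²:  s² − a = d (d + 2τ − 1) = ½ d ((2a − 1) + (3τ − 1)(1 − τ) + τ²).
  √a≤τ+[a-τ²] : 1ℚ ≤ τ + τ + τ → τ * τ ≤ a → √ a ≤ (τ + (a - τ * τ))
  √a≤τ+[a-τ²] 1≤3τ τ²≤a = 0≤s*s-a⇒√a≤s (+-nonNeg 0≤τ 0≤d)
    (subst (0ℚ ≤_) (sym (solve 2 (λ τ a → let d = a :- τ :* τ ; s = τ :+ d in
        s :* s :- a := con ½ :* (d :* ((a :+ a :- con 1ℚ) :+ (τ :+ τ :+ τ :- con 1ℚ) :* (con 1ℚ :- τ) :+ τ :* τ)))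
        refl τ a))
      (*-nonNeg 0≤½ (*-nonNeg 0≤d (+-nonNeg (+-nonNeg 0≤a+a-1
        (*-nonNeg (p≤q⇒0≤q-p 1≤3τ) 0≤1-τ)) (*-nonNeg 0≤τ 0≤τ)))))
    where
    0≤d : 0ℚ ≤ a - τ * τ
    0≤d = p≤q⇒0≤q-p τ²≤a

  -- For s = τ − d/2 with d = τ² − a:  s² − a = d (1 − τ + d/4).
  √a≤τ-½[τ²-a] : a ≤ τ * τ → √ a ≤ (τ - ½ * (τ * τ - a))
  √a≤τ-½[τ²-a] a≤τ² = 0≤s*s-a⇒√a≤s
    (subst (0ℚ ≤_) (sym (solve 2 (λ τ a →
        τ :- con ½ :* (τ :* τ :- a) := con ½ :* (τ :* (con 1ℚ :- τ) :+ τ :+ con ½ :+ con ½ :* (a :+ a :- con 1ℚ)))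
        refl τ a))
      (*-nonNeg 0≤½ (+-nonNeg (+-nonNeg (+-nonNeg (*-nonNeg 0≤τ 0≤1-τ) 0≤τ) 0≤½) (*-nonNeg 0≤½ 0≤a+a-1))))
    (subst (0ℚ ≤_) (sym (solve 2 (λ τ a → let d = τ :* τ :- a ; s = τ :- con ½ :* d in
        s :* s :- a := d :* ((con 1ℚ :- τ) :+ con ½ :* con ½ :* d))
        refl τ a))
      (*-nonNeg 0≤d (+-nonNeg 0≤1-τ (*-nonNeg (*-nonNeg 0≤½ 0≤½) 0≤d))))
    where
    0≤d : 0ℚ ≤ τ * τ - a
    0≤d = p≤q⇒0≤q-p a≤τ²

  √a≤m+a : ∀ {m} → 1ℚ ≤ τ + τ + τ → τ ≤ m + τ * τ → τ + τ ≤ m + m + a + τ * τ → √ a ≤ (m + a)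
  √a≤m+a {m} 1≤3τ τ≤m+τ² 2τ≤2m+a+τ² with ≤-total (τ * τ) a
  ... | inj₁ τ²≤a = √-≤-trans (√a≤τ+[a-τ²] 1≤3τ τ²≤a) (begin
    τ + (a - τ * τ)           ≤⟨ +-monoˡ-≤ (a - τ * τ) τ≤m+τ² ⟩
    m + τ * τ + (a - τ * τ)   ≡⟨ solve 3 (λ τ m a → m :+ τ :* τ :+ (a :- τ :* τ) := m :+ a) refl τ m a ⟩
    m + a                     ∎)
    where open ≤-Reasoning
  ... | inj₂ a≤τ² = √-≤-trans (√a≤τ-½[τ²-a] a≤τ²) (begin
    τ - ½ * (τ * τ - a)                         ≡⟨ solve 2 (λ τ a → τ :- con ½ :* (τ :* τ :- a)
                                                     := con ½ :* (τ :+ τ) :+ con ½ :* (a :- τ :* τ)) refl τ a ⟩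
    ½ * (τ + τ) + ½ * (a - τ * τ)               ≤⟨ +-monoˡ-≤ (½ * (a - τ * τ)) (*-monoˡ-≤-nonNeg ½ 2τ≤2m+a+τ²) ⟩
    ½ * (m + m + a + τ * τ) + ½ * (a - τ * τ)   ≡⟨ solve 3 (λ τ m a → con ½ :* (m :+ m :+ a :+ τ :* τ) :+ con ½ :* (a :- τ :* τ)
                                                     := m :+ a) refl τ m a ⟩
    m + a                                       ∎)
    where open ≤-Reasoning

-- Natural numbers as fractions

ι : ℕ → ℚ
ι k = fromℤ (ℤ.+ k)

ι-suc : ∀ k → ι (suc k) ≡ 1ℚ + ι k
ι-suc k = toℚᵘ-injective (ℚᵘ.≃-trans (ℚᵘ.*≡* eq) (ℚᵘ.≃-sym (toℚᵘ-homo-+ 1ℚ (ι k))))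
  where
  eq : ℤ.+ suc k ℤ.* ℤ.+ 1 ≡ (ℤ.+ 1 ℤ.* ℤ.+ 1 ℤ.+ ℤ.+ k ℤ.* ℤ.+ 1) ℤ.* ℤ.+ 1
  eq rewrite ℤ.*-identityʳ (ℤ.+ k) = refl

ι-+ : ∀ a b → ι (a ℕ.+ b) ≡ ι a + ι b
ι-+ zero    b = sym (+-identityˡ (ι b))
ι-+ (suc a) b = begin
  ι (suc (a ℕ.+ b))    ≡⟨ ι-suc (a ℕ.+ b) ⟩
  1ℚ + ι (a ℕ.+ b)     ≡⟨ cong (1ℚ +_) (ι-+ a b) ⟩
  1ℚ + (ι a + ι b)     ≡⟨ +-assoc 1ℚ (ι a) (ι b) ⟨
  1ℚ + ι a + ι b       ≡⟨ cong (_+ ι b) (ι-suc a) ⟨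
  ι (suc a) + ι b      ∎
  where open ≡-Reasoning

ι-* : ∀ a b → ι (a ℕ.* b) ≡ ι a * ι b
ι-* zero    b = sym (*-zeroˡ (ι b))
ι-* (suc a) b = begin
  ι (b ℕ.+ a ℕ.* b)    ≡⟨ ι-+ b (a ℕ.* b) ⟩
  ι b + ι (a ℕ.* b)    ≡⟨ cong (ι b +_) (ι-* a b) ⟩
  ι b + ι a * ι b      ≡⟨ solve 2 (λ x y → y :+ x :* y := (con 1ℚ :+ x) :* y) refl (ι a) (ι b) ⟩
  (1ℚ + ι a) * ι b     ≡⟨ cong (_* ι b) (ι-suc a) ⟨
  ι (suc a) * ι b      ∎
  where open ≡-Reasoning

ι-mono-≤ : ∀ {a b} → a ℕ.≤ b → ι a ≤ ι b
ι-mono-≤ {a} a≤b with ℕ.m≤n⇒∃[o]m+o≡n a≤b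
... | k , refl = begin
  ι a          ≡⟨ +-identityʳ (ι a) ⟨
  ι a + 0ℚ     ≤⟨ +-monoʳ-≤ (ι a) (nonNegative⁻¹ (ι k)) ⟩
  ι a + ι k    ≡⟨ ι-+ a k ⟨
  ι (a ℕ.+ k)  ∎
  where open ≤-Reasoning

ι-pos : ∀ k .{{_ : NonZero k}} → Positive (ι k)
ι-pos (suc k) = _

ratio-nonNeg : ∀ a n → 0ℚ ≤ ratio a n
ratio-nonNeg a zero    = ≤-refl
ratio-nonNeg a (suc k) = nonNegative⁻¹ (ratio a (suc k)) {{normalize-nonNeg a (suc k)}}

eventually-ratio-1-≤ : ∀ δ → 0ℚ < δ → Σ ℕ λ N → ∀ n → N ℕ.≤ n → ratio 1 n ≤ δ
eventually-ratio-1-≤ (mkℚ (ℤ.+ zero)  _ _) (*<* (ℤ.+<+ ()))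
eventually-ratio-1-≤ (mkℚ ℤ.-[1+ _ ]  _ _) (*<* ())
eventually-ratio-1-≤ (mkℚ (ℤ.+ suc p) d _) _ = suc d , ratio-1-≤
  where
  ratio-1-≤ : ∀ n → suc d ℕ.≤ n → ratio 1 n ≤ mkℚ (ℤ.+ suc p) d _
  ratio-1-≤ (suc k) d<n = toℚᵘ-cancel-≤ (ℚᵘ.≤-respˡ-≃ (ℚᵘ.≃-sym (toℚᵘ-fromℚᵘ (ℚᵘ.mkℚᵘ (ℤ.+ 1) k)))
    (ℚᵘ.*≤* (subst₂ ℤ._≤_ (sym (ℤ.*-identityˡ _)) (ℤ.pos-* (suc p) (suc k))
      (ℤ.+≤+ (ℕ.≤-trans d<n (ℕ.m≤n*m (suc k) (suc p)))))))

-- p ≐ a / k says that p is the fraction a/k.  It is a record rather than the equation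
-- p * ι k ≡ ι a itself so that p can be read off from the type by unification.
infix 4 _≐_/_

record _≐_/_ (p : ℚ) (a k : ℕ) : Set where
  constructor ≐⁺
  field ≐⁻ : p * ι k ≡ ι a

open _≐_/_

ratio-≐ : ∀ a k .{{_ : NonZero k}} → ratio a k ≐ a / k
ratio-≐ a (suc k) = ≐⁺ (toℚᵘ-injective (ℚᵘ.≃-trans (toℚᵘ-homo-* (ratio a (suc k)) (ι (suc k)))
  (ℚᵘ.≃-trans (ℚᵘ.*-congʳ (toℚᵘ-fromℚᵘ (ℚᵘ.mkℚᵘ (ℤ.+ a) k))) (ℚᵘ.*≡* eq))))
  where
  eq : (ℤ.+ a ℤ.* ℤ.+ suc k) ℤ.* ℤ.+ 1 ≡ ℤ.+ a ℤ.* ℤ.+ (suc k ℕ.* 1)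
  eq rewrite ℕ.*-identityʳ k = ℤ.*-identityʳ _

1≐ : ∀ k → 1ℚ ≐ k / k
1≐ k = ≐⁺ (*-identityˡ (ι k))

module _ {p q : ℚ} {a b k : ℕ} where

  ≐-+ : p ≐ a / k → q ≐ b / k → p + q ≐ a ℕ.+ b / k
  ≐-+ (≐⁺ p≐) (≐⁺ q≐) = ≐⁺ (trans (*-distribʳ-+ (ι k) p q) (trans (cong₂ _+_ p≐ q≐) (sym (ι-+ a b))))

  ≐-* : ∀ {l} → p ≐ a / k → q ≐ b / l → p * q ≐ a ℕ.* b / k ℕ.* l
  ≐-* {l} (≐⁺ p≐) (≐⁺ q≐) = ≐⁺ (begin
    p * q * ι (k ℕ.* l)     ≡⟨ cong (p * q *_) (ι-* k l) ⟩
    p * q * (ι k * ι l)     ≡⟨ solve 4 (λ p q x y → p :* q :* (x :* y) := (p :* x) :* (q :* y)) refl p q (ι k) (ι l) ⟩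
    (p * ι k) * (q * ι l)   ≡⟨ cong₂ _*_ p≐ q≐ ⟩
    ι a * ι b               ≡⟨ ι-* a b ⟨
    ι (a ℕ.* b)             ∎)
    where open ≡-Reasoning

  ≐-mono-≤ : .{{_ : NonZero k}} → p ≐ a / k → q ≐ b / k → a ℕ.≤ b → p ≤ q
  ≐-mono-≤ (≐⁺ p≐) (≐⁺ q≐) a≤b =
    *-cancelʳ-≤-pos (ι k) {{ι-pos k}} (subst₂ _≤_ (sym p≐) (sym q≐) (ι-mono-≤ a≤b))

module _ {p : ℚ} {a k : ℕ} where

  ≐-scaleʳ : ∀ l → p ≐ a / k → p ≐ a ℕ.* l / k ℕ.* l
  ≐-scaleʳ l (≐⁺ p≐) = ≐⁺ (begin
    p * ι (k ℕ.* l)    ≡⟨ cong (p *_) (ι-* k l) ⟩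
    p * (ι k * ι l)    ≡⟨ *-assoc p (ι k) (ι l) ⟨
    p * ι k * ι l      ≡⟨ cong (_* ι l) p≐ ⟩
    ι a * ι l          ≡⟨ ι-* a l ⟨
    ι (a ℕ.* l)        ∎)
    where open ≡-Reasoning

  ≐-scaleˡ : ∀ l → p ≐ a / k → p ≐ l ℕ.* a / l ℕ.* k
  ≐-scaleˡ l p≐ = subst₂ (p ≐_/_) (ℕ.*-comm a l) (ℕ.*-comm k l) (≐-scaleʳ l p≐)

≐-unique : ∀ {p q a k} .{{_ : NonZero k}} → p ≐ a / k → q ≐ a / k → p ≡ q
≐-unique p≐ q≐ = ≤-antisym (≐-mono-≤ p≐ q≐ ℕ.≤-refl) (≐-mono-≤ q≐ p≐ ℕ.≤-refl)

ratio-suc : ∀ a n .{{_ : NonZero n}} → ratio (suc a) n ≡ ratio a n + ratio 1 n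
ratio-suc a n = ≐-unique (ratio-≐ (suc a) n)
  (subst (λ b → ratio a n + ratio 1 n ≐ b / n) (ℕ.+-comm a 1) (≐-+ (ratio-≐ a n) (ratio-≐ 1 n)))

1-ratio≡ratio : ∀ {r b} E .{{_ : NonZero E}} → r ℕ.+ b ≡ E → 1ℚ - ratio b E ≡ ratio r E
1-ratio≡ratio {r} {b} E r+b≡E = ≐-unique (≐⁺ (begin
  (1ℚ - ratio b E) * ι E    ≡⟨ solve 2 (λ x e → (con 1ℚ :- x) :* e := e :- x :* e) refl (ratio b E) (ι E) ⟩
  ι E - ratio b E * ι E     ≡⟨ cong₂ _-_ (trans (cong ι (sym r+b≡E)) (ι-+ r b)) (≐⁻ (ratio-≐ b E)) ⟩
  ι r + ι b - ι b           ≡⟨ solve 2 (λ x y → x :+ y :- y := x) refl (ι r) (ι b) ⟩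
  ι r                       ∎)) (ratio-≐ r E)
  where open ≡-Reasoning

ratio-halve-≤ : ∀ r E k .{{_ : NonZero E}} .{{_ : NonZero k}} → E ℕ.+ E ℕ.≤ k → ratio (r ℕ.+ r) k ≤ ratio r E
ratio-halve-≤ r E k E+E≤k =
  ≐-mono-≤ {{ℕ.m*n≢0 k E}} (≐-scaleʳ E (ratio-≐ (r ℕ.+ r) k)) (≐-scaleˡ k (ratio-≐ r E)) (begin
  (r ℕ.+ r) ℕ.* E       ≡⟨ ℕ.*-distribʳ-+ E r r ⟩
  r ℕ.* E ℕ.+ r ℕ.* E   ≡⟨ ℕ.*-distribˡ-+ r E E ⟨
  r ℕ.* (E ℕ.+ E)       ≤⟨ ℕ.*-monoʳ-≤ r E+E≤k ⟩
  r ℕ.* k               ≡⟨ ℕ.*-comm r k ⟩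
  k ℕ.* r               ∎)
  where open ℕ.≤-Reasoning

common-neighbourhood-bound : ∀ {n} {c : Colouring n} → 2 ℕ.≤ n → Symmetric c → blueCount c ℕ.≤ redCount c →
  (N : CommonNeighbourhood c) → let open CommonNeighbourhood N in
  √ ratio (redCount c) (n C 2) ≤ (ratio (suc ∣ S ∣) n + ratio (redCount c) (n C 2))
common-neighbourhood-bound {1} (s≤s ()) _ _ _
common-neighbourhood-bound {suc (suc k)} {c} 2≤n c-sym b≤r N =
  √a≤m+a (ratio-nonNeg Δ n) τ≤1 1≤a+a {m = m} 1≤3τ τ≤m+τ² 2τ≤2m+a+τ²
  where
  open CommonNeighbourhood N
  n = suc (suc k)
  E = n C 2
  r = redCount c
  instance
    E≢0 : NonZero E
    E≢0 = C2-nonZero k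
  τ m a ρ : ℚ
  τ = ratio Δ n
  m = ratio (suc ∣ S ∣) n
  a = ratio r E
  ρ = ratio (r ℕ.+ r) (n ℕ.* n)
  E+E+n≡n² : E ℕ.+ E ℕ.+ n ≡ n ℕ.* n
  E+E+n≡n² = C2-double n
  E≤r+r : E ℕ.≤ r ℕ.+ r
  E≤r+r = subst (ℕ._≤ r ℕ.+ r) (redCount+blueCount c-sym) (ℕ.+-monoʳ-≤ r b≤r)
  τ≤1 : τ ≤ 1ℚ
  τ≤1 = ≐-mono-≤ (ratio-≐ Δ n) (1≐ n) Δ≤n
  1≤3τ : 1ℚ ≤ τ + τ + τ
  1≤3τ = ≐-mono-≤ (1≐ n) (≐-+ (≐-+ (ratio-≐ Δ n) (ratio-≐ Δ n)) (ratio-≐ Δ n))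
    (n≤3Δ {r = r} 2≤n E+E+n≡n² E≤r+r Δ R+R≤nΔ)
  1≤a+a : 1ℚ ≤ a + a
  1≤a+a = ≐-mono-≤ (1≐ E) (≐-+ (ratio-≐ r E) (ratio-≐ r E)) E≤r+r
  τ≤m+τ² : τ ≤ m + τ * τ
  τ≤m+τ² = ≐-mono-≤ (≐-scaleʳ n (ratio-≐ Δ n))
    (≐-+ (≐-scaleʳ n (ratio-≐ (suc ∣ S ∣) n)) (≐-* (ratio-≐ Δ n) (ratio-≐ Δ n))) (Δn≤[S+1]n+ΔΔ N)
  ρ≤a : ρ ≤ a
  ρ≤a = ratio-halve-≤ r E (n ℕ.* n) (ℕ.m+n≤o⇒m≤o (E ℕ.+ E) (ℕ.≤-reflexive E+E+n≡n²))
  2τ≤2m+a+τ² : τ + τ ≤ m + m + a + τ * τ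
  2τ≤2m+a+τ² = ≤-trans
    (≐-mono-≤ (≐-scaleʳ n (≐-+ (ratio-≐ Δ n) (ratio-≐ Δ n)))
      (≐-+ (≐-+ (≐-scaleʳ n (≐-+ (ratio-≐ (suc ∣ S ∣) n) (ratio-≐ (suc ∣ S ∣) n))) (ratio-≐ (r ℕ.+ r) (n ℕ.* n)))
        (≐-* (ratio-≐ Δ n) (ratio-≐ Δ n)))
      ([Δ+Δ]n≤[2S+2]n+[R+R]+ΔΔ N))
    (+-monoˡ-≤ (τ * τ) (+-monoʳ-≤ (m + m) ρ≤a))

RedBlueSet : ∀ {n} → Colouring n → ℚ → Set
RedBlueSet {n} c δ = Σ (Fin n) λ x → Σ (Fin n) λ y → Σ (Subset n) λ S →
  (∀ v → v ∈ S → (v ≢ x) × (v ≢ y) × (c v x ≡ true) × (c v y ≡ false)) ×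
  (√ (1ℚ - balance c) ≤ (ratio ∣ S ∣ n + (1ℚ - balance c) + δ))

red-majority : ∀ {n δ} {c : Colouring n} → 2 ℕ.≤ n → ratio 1 n ≤ δ → Symmetric c →
  blueCount c ℕ.≤ redCount c → CommonNeighbourhood c → RedBlueSet c δ
red-majority {1} (s≤s ()) _ _ _ _
red-majority {suc (suc k)} {δ} {c} 2≤n 1/n≤δ c-sym b≤r N = x , y , S , S-spec ,
  √-≤-trans (subst (λ a → √ a ≤ (ratio (suc M) n + a)) (sym 1-ε≡a) (common-neighbourhood-bound 2≤n c-sym b≤r N))
    (begin
      ratio (suc M) n + (1ℚ - balance c)         ≡⟨ cong (_+ (1ℚ - balance c)) (ratio-suc M n) ⟩
      ratio M n + ratio 1 n + (1ℚ - balance c)   ≤⟨ +-monoˡ-≤ (1ℚ - balance c) (+-monoʳ-≤ (ratio M n) 1/n≤δ) ⟩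
      ratio M n + δ + (1ℚ - balance c)           ≡⟨ solve 3 (λ m d a → m :+ d :+ a := m :+ a :+ d)
                                                      refl (ratio M n) δ (1ℚ - balance c) ⟩
      ratio M n + (1ℚ - balance c) + δ           ∎)
  where
  open CommonNeighbourhood N
  open ≤-Reasoning
  n = suc (suc k)
  M = ∣ S ∣
  1-ε≡a : 1ℚ - balance c ≡ ratio (redCount c) (n C 2)
  1-ε≡a = trans (cong (λ b → 1ℚ - ratio b (n C 2)) (ℕ.m≥n⇒m⊓n≡n b≤r))
    (1-ratio≡ratio (n C 2) {{C2-nonZero k}} (redCount+blueCount c-sym))

balance-swapColours : ∀ {n} (c : Colouring n) → balance (swapColours c) ≡ balance c
balance-swapColours {n} c = cong (λ b → ratio b (n C 2))
  (trans (cong (blueCount c ℕ.⊓_) (blueCount-swapColours c)) (ℕ.⊓-comm (blueCount c) (redCount c)))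

RedBlueSet-swapColours : ∀ {n δ} {c : Colouring n} → RedBlueSet (swapColours c) δ → RedBlueSet c δ
RedBlueSet-swapColours {n} {δ} {c} (x , y , S , S-spec , bound) = y , x , S , S-spec′ ,
  subst (λ ε → √ (1ℚ - ε) ≤ (ratio ∣ S ∣ n + (1ℚ - ε) + δ)) (balance-swapColours c) bound
  where
  S-spec′ : ∀ v → v ∈ S → (v ≢ y) × (v ≢ x) × (c v y ≡ true) × (c v x ≡ false)
  S-spec′ v v∈S = let v≢x , v≢y , vx-blue , vy-red = S-spec v v∈S in
    v≢y , v≢x , not-injective vy-red , not-injective vx-blue

red-blue-set : ∀ {n δ} → 2 ℕ.≤ n → ratio 1 n ≤ δ → (c : Colouring n) → Symmetric c → RedBlueSet c δ
red-blue-set {1} (s≤s ())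
red-blue-set {suc (suc k)} 2≤n 1/n≤δ c c-sym with blueCount c ℕ.≤? redCount c
... | yes b≤r = red-majority 2≤n 1/n≤δ c-sym b≤r (MaxRedDegree.commonNeighbourhood c-sym zero)
... | no b≰r  = RedBlueSet-swapColours (red-majority 2≤n 1/n≤δ (swapColours-sym c-sym)
  (subst (ℕ._≤ blueCount c) (sym (blueCount-swapColours c)) (ℕ.<⇒≤ (ℕ.≰⇒> b≰r)))
  (MaxRedDegree.commonNeighbourhood (swapColours-sym c-sym) zero))

lemma3 : (δ : ℚ) → 0ℚ < δ →
    Σ ℕ λ N → (n : ℕ) → N Data.Nat.≤ n →
    (c : Fin n → Fin n → Bool) → (∀ i j → c i j ≡ c j i) →
    Σ (Fin n) λ x → Σ (Fin n) λ y → Σ (Subset n) λ S →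
      (∀ v → v ∈ S → (v ≢ x) × (v ≢ y) × (c v x ≡ true) × (c v y ≡ false)) ×
      (√ (1ℚ - balance c) ≤ (ratio ∣ S ∣ n + (1ℚ - balance c) + δ))
lemma3 δ 0<δ = N ℕ.+ 2 , λ n N+2≤n →
  red-blue-set (ℕ.m+n≤o⇒n≤o N N+2≤n) (1/n≤δ n (ℕ.m+n≤o⇒m≤o N N+2≤n))
  where
  N = proj₁ (eventually-ratio-1-≤ δ 0<δ)
  1/n≤δ = proj₂ (eventually-ratio-1-≤ δ 0<δ)
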